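{- For every nonnegative integer $k$, $\Delta(6k+3,k) < 0$.
   Context: For integers $n \ge 1$ and $k \ge 0$, $JL_{n,k} = \sum_{i=k}^{\lfloor n/2 \rfloor} \frac{n}{n-i} \binom{n-i}{i} \binom{i}{k}$ (empty sum $=0$), and $\Delta(n,k) = JL_{n,k+1} - JL_{n,k}$. -}

module Defs where

open import Data.Nat using (ℕ; zero; suc; _∸_)
import Data.Nat as ℕ
open import Data.Nat.Combinatorics using (_C_)
open import Data.Integer using (+_)
open import Data.Rational using (ℚ; 0ℚ; _/_; _*_; _-_)
import Data.Rational as ℚ
open import Data.List using (List; map; upTo; foldr)

range : ℕ → ℕ → List ℕ
range a b = map (a ℕ.+_) (upTo (suc b ∸ a))

sumFromTo : ℕ → ℕ → (ℕ → ℚ) → ℚ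
sumFromTo a b f = foldr ℚ._+_ 0ℚ (map f (range a b))

-- n/(n-i) as a rational.  The denominator is written suc (n ∸ suc i), which
-- equals n - i whenever i < n; in JL below i ≤ ⌊n/2⌋ < n since n ≥ 1.
ratio : ℕ → ℕ → ℚ
ratio n i = (+ n) / suc (n ∸ suc i)

JL : ℕ → ℕ → ℚ
JL n k = sumFromTo k (n ℕ./ 2) (λ i → ratio n i * ((+ ((n ∸ i) C i)) / 1) * ((+ (i C k)) / 1))

Δ : ℕ → ℕ → ℚ
Δ n k = JL n (suc k) - JL n k

-- Write w(n,i) = n/(n-i)·C(n-i,i), a natural number, so that JL_{n,c} = Σ_{c ≤ i ≤ ⌊n/2⌋} w(n,i)·C(i,c).
-- For n = 6k+3 we have ⌊n/2⌋ = 3k+1, and (k+1)·C(i,k+1) = (i-k)·C(i,k) makes the summand of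
-- JL_{n,k+1} - JL_{n,k} at i ≥ k+1 equal to (i-2k-1)/(k+1)·w(n,i)·C(i,k). Pairing i = 2k+1-j with
-- i = 2k+1+j, each pair contributes j/(k+1)·(w(n,2k+1+j)·C(2k+1+j,k) - w(n,2k+1-j)·C(2k+1-j,k)) ≤ 0:
-- with the closed form w(n,i)·C(i,k) = n·(n-i-1)!/(k!·(i-k)!·(n-2i)!) this is a factorial inequality,
-- proved by induction on j. The middle term i = 2k+1 vanishes and the term i = k of JL_{n,k} is
-- positive, so Δ(6k+3,k) < 0.

module Submission where

open import Defs
open import Data.Nat using (ℕ; _+_; _*_)
open import Data.Rational using (0ℚ; _<_)

import Data.Nat as ℕ
open import Data.Nat using (zero; suc; _∸_; _≤_; _!; NonZero; ≢-nonZero; >-nonZero⁻¹; z≤n; s≤s; s≤s⁻¹; z<s; s<s)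
open import Data.Nat.Properties
open import Data.Nat.Combinatorics using (_C_; nCk≡n!/k![n-k]!; k![n∸k]!∣n!; nCk≡nC[n∸k])
open import Data.Nat.DivMod using (m/n*n≡m; m/n*n≤m; m/n<m; m*n/n≡m; +-distrib-/-∣ʳ)
open import Data.Nat.Divisibility using (n∣m*n)
open import Data.Nat.Tactic.RingSolver using (solve-∀; solve)
open import Data.List using ([]; _∷_; map; foldr; applyUpTo; upTo)
open import Data.List.Properties using (map-∘)
open import Data.Product using (_×_; _,_)
import Data.Integer as ℤ using (ℤ; _*_; _+_; +_; +<+)
open import Data.Integer.GCD using (gcd)
import Data.Integer.Properties as ℤP
open import Data.Integer.Tactic.RingSolver renaming (solve-∀ to ℤ-solve-∀) using ()
open import Data.Rational as ℚ using (ℚ; ↥_; ↧_; toℚᵘ)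
import Data.Rational.Properties as ℚP
open import Data.Rational.Unnormalised as ℚᵘ using (mkℚᵘ; *≡*; *<*) renaming (_≃_ to _≃ᵘ_)
import Data.Rational.Unnormalised.Properties as ℚᵘP
open import Relation.Binary.PropositionalEquality
open import Function using (_∘_; id)
open import Algebra.Properties.CommutativeSemigroup *-commutativeSemigroup using (x∙yz≈y∙xz; x∙yz≈xz∙y)

m+d≡n⇒m≤n : ∀ {m n} d → m + d ≡ n → m ≤ n
m+d≡n⇒m≤n {m} d refl = m≤m+n m d

_!*_!*_!≢0 : ∀ a b c → NonZero (a ! * b ! * c !)
a !* b !* c !≢0 = m*n≢0 (a ! * b !) (c !) {{a !* b !≢0}} {{c !≢0}}

cross-≤ : ∀ {p q x y u v} .{{_ : NonZero p}} .{{_ : NonZero q}} →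
          p * x ≡ u → q * y ≡ v → q * u ≤ p * v → x ≤ y
cross-≤ {p} {q} {x} {y} {u} {v} p*x≡u q*y≡v q*u≤p*v = *-cancelˡ-≤ (p * q) {{m*n≢0 p q}} (begin
  p * q * x     ≡⟨ cong (_* x) (*-comm p q) ⟩
  q * p * x     ≡⟨ *-assoc q p x ⟩
  q * (p * x)   ≡⟨ cong (q *_) p*x≡u ⟩
  q * u         ≤⟨ q*u≤p*v ⟩
  p * v         ≡⟨ cong (p *_) q*y≡v ⟨
  p * (q * y)   ≡⟨ *-assoc p q y ⟨
  p * q * y     ∎)
  where open ≤-Reasoning

ratio-step-≤ : ∀ {X Y x y a b s t} .{{_ : NonZero a}} .{{_ : NonZero b}} →
               X * a ≡ x * s → Y * b ≡ y * t → x ≤ y → s * b ≤ t * a → X ≤ Y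
ratio-step-≤ {X} {Y} {x} {y} {a} {b} {s} {t} X*a≡x*s Y*b≡y*t x≤y s*b≤t*a =
  *-cancelʳ-≤ X Y (a * b) {{m*n≢0 a b}} (begin
    X * (a * b)    ≡⟨ *-assoc X a b ⟨
    X * a * b      ≡⟨ cong (_* b) X*a≡x*s ⟩
    x * s * b      ≡⟨ *-assoc x s b ⟩
    x * (s * b)    ≤⟨ *-mono-≤ x≤y s*b≤t*a ⟩
    y * (t * a)    ≡⟨ *-assoc y t a ⟨
    y * t * a      ≡⟨ cong (_* a) Y*b≡y*t ⟨
    Y * b * a      ≡⟨ x∙yz≈xz∙y Y a b ⟨
    Y * (a * b)    ∎)
  where open ≤-Reasoning

shift-pair-≤ : ∀ r j {a b a′ b′} → suc (r + j) * a′ ≡ suc r * a → suc (r + j) * b′ ≡ suc (r + j + j) * b →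
               b ≤ a → a′ + b′ ≤ a + b
shift-pair-≤ r j {a} {b} {a′} {b′} h₁ h₂ b≤a = *-cancelˡ-≤ (suc (r + j)) (begin
  suc (r + j) * (a′ + b′)                   ≡⟨ *-distribˡ-+ (suc (r + j)) a′ b′ ⟩
  suc (r + j) * a′ + suc (r + j) * b′       ≡⟨ cong₂ _+_ h₁ h₂ ⟩
  suc r * a + suc (r + j + j) * b           ≡⟨ solve (r ∷ j ∷ a ∷ b ∷ []) ⟩
  suc r * a + suc (r + j) * b + j * b       ≤⟨ +-monoʳ-≤ (suc r * a + suc (r + j) * b) (*-monoʳ-≤ j b≤a) ⟩
  suc r * a + suc (r + j) * b + j * a       ≡⟨ solve (r ∷ j ∷ a ∷ b ∷ []) ⟩
  suc (r + j) * (a + b)                     ∎)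
  where open ≤-Reasoning

factorial-shift : ∀ {x y z x′ y′ z′} → suc x ≡ x′ → suc (suc y) ≡ y′ → suc z ≡ z′ →
                  x ! * y′ ! * z ! * (suc x * suc z) ≡ x′ ! * y ! * z′ ! * (suc (suc y) * suc y)
factorial-shift {x} {y} {z} refl refl refl = lemma x y z (x !) (y !) (z !)
  where
  lemma : ∀ x y z X Y Z → X * (suc (suc y) * (suc y * Y)) * Z * (suc x * suc z)
                          ≡ suc x * X * Y * (suc z * Z) * (suc (suc y) * suc y)
  lemma = solve-∀

[m+d]Cm*[m!*d!]≡[m+d]! : ∀ m d → ((m + d) C m) * (m ! * d !) ≡ (m + d) !
[m+d]Cm*[m!*d!]≡[m+d]! m d = begin
  ((m + d) C m) * (m ! * d !)
    ≡⟨ cong (λ x → ((m + d) C m) * (m ! * x !)) (m+n∸m≡n m d) ⟨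
  ((m + d) C m) * (m ! * (m + d ∸ m) !)
    ≡⟨ cong (_* (m ! * (m + d ∸ m) !)) (nCk≡n!/k![n-k]! (m≤m+n m d)) ⟩
  _
    ≡⟨ m/n*n≡m {{m !* (m + d ∸ m) !≢0}} (k![n∸k]!∣n! (m≤m+n m d)) ⟩
  (m + d) ! ∎
  where open ≡-Reasoning

[k+1]*[k+1+d]C[k+1]≡[d+1]*[k+1+d]Ck : ∀ k d → suc k * ((k + suc d) C suc k) ≡ suc d * ((k + suc d) C k)
[k+1]*[k+1+d]C[k+1]≡[d+1]*[k+1+d]Ck k d = *-cancelʳ-≡ _ _ (k ! * d !) {{k !* d !≢0}} (begin
  suc k * (n C suc k) * (k ! * d !)         ≡⟨ regroup (suc k) (n C suc k) (k !) (d !) ⟩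
  (n C suc k) * (suc k ! * d !)             ≡⟨ cong (λ x → (x C suc k) * (suc k ! * d !)) (+-suc k d) ⟩
  ((suc k + d) C suc k) * (suc k ! * d !)   ≡⟨ [m+d]Cm*[m!*d!]≡[m+d]! (suc k) d ⟩
  (suc k + d) !                             ≡⟨ cong _! (+-suc k d) ⟨
  n !                                       ≡⟨ [m+d]Cm*[m!*d!]≡[m+d]! k (suc d) ⟨
  (n C k) * (k ! * suc d !)                 ≡⟨ regroup′ (suc d) (n C k) (k !) (d !) ⟩
  suc d * (n C k) * (k ! * d !)             ∎)
  where
  open ≡-Reasoning
  n : ℕ
  n = k + suc d
  regroup : ∀ a c x y → a * c * (x * y) ≡ c * (a * x * y)
  regroup = solve-∀
  regroup′ : ∀ a c x y → c * (x * (a * y)) ≡ a * c * (x * y)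
  regroup′ = solve-∀

[n+1]*nCk≡[k+1]*[n+1]C[k+1] : ∀ k d → suc (k + d) * ((k + d) C k) ≡ suc k * ((suc k + d) C suc k)
[n+1]*nCk≡[k+1]*[n+1]C[k+1] k d = *-cancelʳ-≡ _ _ (k ! * d !) {{k !* d !≢0}} (begin
  suc (k + d) * ((k + d) C k) * (k ! * d !)     ≡⟨ *-assoc (suc (k + d)) ((k + d) C k) (k ! * d !) ⟩
  suc (k + d) * (((k + d) C k) * (k ! * d !))   ≡⟨ cong (suc (k + d) *_) ([m+d]Cm*[m!*d!]≡[m+d]! k d) ⟩
  suc (k + d) !                                 ≡⟨ [m+d]Cm*[m!*d!]≡[m+d]! (suc k) d ⟨
  ((suc k + d) C suc k) * (suc k ! * d !)       ≡⟨ regroup (suc k) ((suc k + d) C suc k) (k !) (d !) ⟩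
  suc k * ((suc k + d) C suc k) * (k ! * d !)   ∎)
  where
  open ≡-Reasoning
  regroup : ∀ a c x y → c * (a * x * y) ≡ a * c * (x * y)
  regroup = solve-∀

-- n/(n-i)·C(n-i,i), written as C(n-i,i) + C(n-i-1,i-1) so that it is visibly a natural number.
lucasCoeff : ℕ → ℕ → ℕ
lucasCoeff n zero    = 1
lucasCoeff n (suc i) = (n ∸ suc i) C suc i + (n ∸ suc (suc i)) C i

[i+d]*lucasCoeff≡n*[i+d]Ci : ∀ {n} i d → i + i + d ≡ n → (i + d) * lucasCoeff n i ≡ n * ((i + d) C i)
[i+d]*lucasCoeff≡n*[i+d]Ci zero    d refl = refl
[i+d]*lucasCoeff≡n*[i+d]Ci (suc i) d refl = begin
  (suc i + d) * ((n ∸ suc i) C suc i + (n ∸ suc (suc i)) C i)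
    ≡⟨ cong₂ (λ x y → (suc i + d) * (x C suc i + y C i)) n∸[i+1]≡i+1+d n∸[i+2]≡i+d ⟩
  (suc i + d) * (X + (i + d) C i)
    ≡⟨ *-distribˡ-+ (suc i + d) X ((i + d) C i) ⟩
  (suc i + d) * X + suc (i + d) * ((i + d) C i)
    ≡⟨ cong ((suc i + d) * X +_) ([n+1]*nCk≡[k+1]*[n+1]C[k+1] i d) ⟩
  (suc i + d) * X + suc i * X
    ≡⟨ *-distribʳ-+ X (suc i + d) (suc i) ⟨
  (suc i + d + suc i) * X
    ≡⟨ cong (_* X) i+1+d+[i+1]≡n ⟩
  n * X ∎
  where
  open ≡-Reasoning
  n X : ℕ
  n = suc i + suc i + d
  X = (suc i + d) C suc i
  i+1+d+[i+1]≡n : suc i + d + suc i ≡ suc i + suc i + d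
  i+1+d+[i+1]≡n = solve (i ∷ d ∷ [])
  n≡2+i+[i+d] : suc i + suc i + d ≡ suc (suc i) + (i + d)
  n≡2+i+[i+d] = solve (i ∷ d ∷ [])
  n∸[i+1]≡i+1+d : n ∸ suc i ≡ suc i + d
  n∸[i+1]≡i+1+d = trans (cong (_∸ suc i) (+-assoc (suc i) (suc i) d)) (m+n∸m≡n (suc i) (suc i + d))
  n∸[i+2]≡i+d : n ∸ suc (suc i) ≡ i + d
  n∸[i+2]≡i+d = trans (cong (_∸ suc (suc i)) n≡2+i+[i+d]) (m+n∸m≡n (suc (suc i)) (i + d))

[n∸i]*lucasCoeff≡n*[n∸i]Ci : ∀ {n i} → i + i ≤ n → (n ∸ i) * lucasCoeff n i ≡ n * ((n ∸ i) C i)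
[n∸i]*lucasCoeff≡n*[n∸i]Ci {n} {i} 2i≤n = begin
  (n ∸ i) * lucasCoeff n i  ≡⟨ cong (_* lucasCoeff n i) n∸i≡i+d ⟩
  (i + d) * lucasCoeff n i  ≡⟨ [i+d]*lucasCoeff≡n*[i+d]Ci i d (m+[n∸m]≡n 2i≤n) ⟩
  n * ((i + d) C i)         ≡⟨ cong (λ x → n * (x C i)) n∸i≡i+d ⟨
  n * ((n ∸ i) C i)         ∎
  where
  open ≡-Reasoning
  d : ℕ
  d = n ∸ (i + i)
  n∸i≡i+d : n ∸ i ≡ i + d
  n∸i≡i+d = begin
    n ∸ i             ≡⟨ cong (_∸ i) (m+[n∸m]≡n 2i≤n) ⟨
    i + i + d ∸ i     ≡⟨ cong (_∸ i) (+-assoc i i d) ⟩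
    i + (i + d) ∸ i   ≡⟨ m+n∸m≡n i (i + d) ⟩
    i + d             ∎

lucasCoeff*C≡factorials : ∀ {n i m} k a e → k + a ≡ i → i + i + suc e ≡ n → i + e ≡ m →
                          k ! * a ! * suc e ! * (lucasCoeff n i * (i C k)) ≡ n * m !
lucasCoeff*C≡factorials {n} {i} k a e refl i+i+[e+1]≡n refl =
  *-cancelˡ-≡ _ _ (suc (i + e)) (begin
    suc (i + e) * (k ! * a ! * suc e ! * (w * (i C k)))
      ≡⟨ regroup (suc (i + e)) (k !) (a !) (suc e !) w (i C k) ⟩
    ((i C k) * (k ! * a !)) * (suc e ! * (suc (i + e) * w))
      ≡⟨ cong₂ (λ x y → x * (suc e ! * y)) ([m+d]Cm*[m!*d!]≡[m+d]! k a) [i+e+1]*w≡n*C ⟩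
    i ! * (suc e ! * (n * ((i + suc e) C i)))
      ≡⟨ regroup′ n (i !) (suc e !) ((i + suc e) C i) ⟩
    n * (((i + suc e) C i) * (i ! * suc e !))
      ≡⟨ cong (n *_) ([m+d]Cm*[m!*d!]≡[m+d]! i (suc e)) ⟩
    n * (i + suc e) !
      ≡⟨ cong (λ x → n * x !) (+-suc i e) ⟩
    n * (suc (i + e) * (i + e) !)
      ≡⟨ x∙yz≈y∙xz n (suc (i + e)) ((i + e) !) ⟩
    suc (i + e) * (n * (i + e) !) ∎)
  where
  open ≡-Reasoning
  w : ℕ
  w = lucasCoeff n i
  [i+e+1]*w≡n*C : suc (i + e) * w ≡ n * ((i + suc e) C i)
  [i+e+1]*w≡n*C = trans (cong (_* w) (sym (+-suc i e))) ([i+d]*lucasCoeff≡n*[i+d]Ci i (suc e) i+i+[e+1]≡n)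
  regroup : ∀ p x y z w c → p * (x * y * z * (w * c)) ≡ (c * (x * y)) * (z * (p * w))
  regroup = solve-∀
  regroup′ : ∀ n x y c → x * (y * (n * c)) ≡ n * (c * (x * y))
  regroup′ = solve-∀

0<lucasCoeff*C : ∀ {n i} k a e → k + a ≡ i → i + i + suc e ≡ n → 0 ℕ.< lucasCoeff n i * (i C k)
0<lucasCoeff*C {n} {i} k a e k+a≡i i+i+[e+1]≡n =
  >-nonZero⁻¹ _ {{m*n≢0⇒n≢0 (k ! * a ! * suc e !) {{subst NonZero (sym closedForm) n*[i+e]!≢0}}}}
  where
  closedForm : k ! * a ! * suc e ! * (lucasCoeff n i * (i C k)) ≡ n * (i + e) !
  closedForm = lucasCoeff*C≡factorials k a e k+a≡i i+i+[e+1]≡n refl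
  n≢0 : NonZero n
  n≢0 = ≢-nonZero (subst (_≢ 0) i+i+[e+1]≡n (m+1+n≢0 (i + i)))
  n*[i+e]!≢0 : NonZero (n * (i + e) !)
  n*[i+e]!≢0 = m*n≢0 n ((i + e) !) {{n≢0}} {{(i + e) !≢0}}

-- Cross-multiplied comparison of the closed forms at i = 2k+1+j and i = 2k+1-j, where k = r + j.
-- The step (j, r+1) ↦ (j+1, r) multiplies the left side by (2r+4j+5)(2r+4j+4)/((r+2)(4r+3j+5)) and the
-- right side by (r+2j+3)(4r+5j+6)/((2r+3)(2r+2)); cross-multiplied, the difference of the two quartics
-- has nonnegative coefficients.
factorial-ratio-≤ : ∀ j r → suc r ! * suc (2 * r + 4 * j) ! * (4 * r + 3 * j + 1) !
                          ≤ suc (r + j + j) ! * suc (2 * r) ! * (4 * r + 5 * j + 1) !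
factorial-ratio-≤ zero    r =
  ≤-reflexive (cong₂ (λ x y → suc x ! * suc y ! * (4 * r + 0 + 1) !) r≡r+0+0 (+-identityʳ (2 * r)))
  where
  r≡r+0+0 : r ≡ r + 0 + 0
  r≡r+0+0 = solve (r ∷ [])
factorial-ratio-≤ (suc j) r =
  ratio-step-≤ (factorial-shift {x = suc r} refl shift₁ shift₂) (sym (factorial-shift shift₃ shift₄ shift₅))
               (factorial-ratio-≤ j (suc r)) quartic
  where
  shift₁ : suc (suc (suc (2 * suc r + 4 * j))) ≡ suc (2 * r + 4 * suc j)
  shift₁ = solve (j ∷ r ∷ [])
  shift₂ : suc (4 * r + 3 * suc j + 1) ≡ 4 * suc r + 3 * j + 1
  shift₂ = solve (j ∷ r ∷ [])
  shift₃ : suc (suc (suc r + j + j)) ≡ suc (r + suc j + suc j)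
  shift₃ = solve (j ∷ r ∷ [])
  shift₄ : suc (suc (suc (2 * r))) ≡ suc (2 * suc r)
  shift₄ = solve (r ∷ [])
  shift₅ : suc (4 * suc r + 5 * j + 1) ≡ 4 * r + 5 * suc j + 1
  shift₅ = solve (j ∷ r ∷ [])
  quartic : suc (suc (suc (2 * suc r + 4 * j))) * suc (suc (2 * suc r + 4 * j)) * (suc (suc (suc (2 * r))) * suc (suc (2 * r)))
          ≤ suc (suc (suc r + j + j)) * suc (4 * suc r + 5 * j + 1) * (suc (suc r) * suc (4 * r + 3 * suc j + 1))
  quartic = m+d≡n⇒m≤n (60 + 106 * r + 62 * r * r + 12 * r * r * r + 162 * j + 187 * j * r + 51 * j * r * r
                        + 166 * j * j + 129 * j * j * r + 15 * j * j * r * r + 60 * j * j * j + 30 * j * j * j * r)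
                       (solve (j ∷ r ∷ []))

jlTerm : ℕ → ℕ → ℕ → ℕ
jlTerm n k i = lucasCoeff n i * (i C k)

[k+1]*jlTerm≡[d+1]*jlTerm : ∀ {n i} k d → k + suc d ≡ i → suc k * jlTerm n (suc k) i ≡ suc d * jlTerm n k i
[k+1]*jlTerm≡[d+1]*jlTerm {n} {i} k d refl = begin
  suc k * (w * (i C suc k))   ≡⟨ x∙yz≈y∙xz (suc k) w (i C suc k) ⟩
  w * (suc k * (i C suc k))   ≡⟨ cong (w *_) ([k+1]*[k+1+d]C[k+1]≡[d+1]*[k+1+d]Ck k d) ⟩
  w * (suc d * (i C k))       ≡⟨ x∙yz≈y∙xz w (suc d) (i C k) ⟩
  suc d * (w * (i C k))       ∎
  where
  open ≡-Reasoning
  w : ℕ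
  w = lucasCoeff n i

jlTerm-far≤near : ∀ {k} r j → r + j ≡ k → jlTerm (6 * k + 3) k (suc k + (k + j)) ≤ jlTerm (6 * k + 3) k (suc k + r)
jlTerm-far≤near r j refl =
  cross-≤ {{(r + j) !* suc (r + j + j) !* suc (2 * r) !≢0}} {{(r + j) !* suc r !* suc (2 * r + 4 * j) !≢0}}
    (lucasCoeff*C≡factorials (r + j) (suc (r + j + j)) (2 * r) (+-suc (r + j) (r + j + j)) far-size far-top)
    (lucasCoeff*C≡factorials (r + j) (suc r) (2 * r + 4 * j) (+-suc (r + j) r) near-size near-top)
    (begin
      (r + j) ! * suc r ! * suc (2 * r + 4 * j) ! * (n * (4 * r + 3 * j + 1) !)
        ≡⟨ regroup ((r + j) !) (suc r !) (suc (2 * r + 4 * j) !) n ((4 * r + 3 * j + 1) !) ⟩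
      (r + j) ! * n * (suc r ! * suc (2 * r + 4 * j) ! * (4 * r + 3 * j + 1) !)
        ≤⟨ *-monoʳ-≤ ((r + j) ! * n) (factorial-ratio-≤ j r) ⟩
      (r + j) ! * n * (suc (r + j + j) ! * suc (2 * r) ! * (4 * r + 5 * j + 1) !)
        ≡⟨ regroup ((r + j) !) (suc (r + j + j) !) (suc (2 * r) !) n ((4 * r + 5 * j + 1) !) ⟨
      (r + j) ! * suc (r + j + j) ! * suc (2 * r) ! * (n * (4 * r + 5 * j + 1) !) ∎)
  where
  open ≤-Reasoning
  n : ℕ
  n = 6 * (r + j) + 3
  regroup : ∀ x y z n w → x * y * z * (n * w) ≡ x * n * (y * z * w)
  regroup = solve-∀
  far-size : suc (r + j) + (r + j + j) + (suc (r + j) + (r + j + j)) + suc (2 * r) ≡ 6 * (r + j) + 3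
  far-size = solve (r ∷ j ∷ [])
  far-top : suc (r + j) + (r + j + j) + 2 * r ≡ 4 * r + 3 * j + 1
  far-top = solve (r ∷ j ∷ [])
  near-size : suc (r + j) + r + (suc (r + j) + r) + suc (2 * r + 4 * j) ≡ 6 * (r + j) + 3
  near-size = solve (r ∷ j ∷ [])
  near-top : suc (r + j) + r + (2 * r + 4 * j) ≡ 4 * r + 5 * j + 1
  near-top = solve (r ∷ j ∷ [])

jlTerm-pair-≤ : ∀ {k} r j → r + j ≡ k →
                jlTerm (6 * k + 3) (suc k) (suc k + r) + jlTerm (6 * k + 3) (suc k) (suc k + (k + j))
                ≤ jlTerm (6 * k + 3) k (suc k + r) + jlTerm (6 * k + 3) k (suc k + (k + j))
jlTerm-pair-≤ r j refl = shift-pair-≤ r j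
  ([k+1]*jlTerm≡[d+1]*jlTerm {n = 6 * (r + j) + 3} (r + j) r (+-suc (r + j) r))
  ([k+1]*jlTerm≡[d+1]*jlTerm {n = 6 * (r + j) + 3} (r + j) (r + j + j) (+-suc (r + j) (r + j + j)))
  (jlTerm-far≤near r j refl)

sumBelow : (ℕ → ℕ) → ℕ → ℕ
sumBelow f zero    = 0
sumBelow f (suc L) = f 0 + sumBelow (f ∘ suc) L

sumBelow-snoc : ∀ L f → sumBelow f (suc L) ≡ sumBelow f L + f L
sumBelow-snoc zero    f = +-comm (f 0) 0
sumBelow-snoc (suc L) f = trans (cong (f 0 +_) (sumBelow-snoc L (f ∘ suc))) (sym (+-assoc (f 0) _ _))

sumBelow-cong : ∀ L {f g} → f ≗ g → sumBelow f L ≡ sumBelow g L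
sumBelow-cong zero    f≗g = refl
sumBelow-cong (suc L) f≗g = cong₂ _+_ (f≗g 0) (sumBelow-cong L (f≗g ∘ suc))

sumBelow-outerPair : ∀ L f → sumBelow f (suc (suc L + suc L)) ≡ f 0 + f (suc L + suc L) + sumBelow (f ∘ suc) (suc (L + L))
sumBelow-outerPair L f = begin
  f 0 + sumBelow (f ∘ suc) (suc (L + suc L))
    ≡⟨ cong (λ m → f 0 + sumBelow (f ∘ suc) (suc m)) (+-suc L L) ⟩
  f 0 + sumBelow (f ∘ suc) (suc (suc (L + L)))
    ≡⟨ cong (f 0 +_) (sumBelow-snoc (suc (L + L)) (f ∘ suc)) ⟩
  f 0 + (sumBelow (f ∘ suc) (suc (L + L)) + f (suc (suc (L + L))))
    ≡⟨ cong (f 0 +_) (+-comm (sumBelow (f ∘ suc) (suc (L + L))) _) ⟩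
  f 0 + (f (suc (suc (L + L))) + sumBelow (f ∘ suc) (suc (L + L)))
    ≡⟨ +-assoc (f 0) _ _ ⟨
  f 0 + f (suc (suc (L + L))) + sumBelow (f ∘ suc) (suc (L + L))
    ≡⟨ cong (λ m → f 0 + f (suc m) + sumBelow (f ∘ suc) (suc (L + L))) (+-suc L L) ⟨
  f 0 + f (suc L + suc L) + sumBelow (f ∘ suc) (suc (L + L)) ∎
  where open ≡-Reasoning

sumBelow-pairwise-≤ : ∀ L (f g : ℕ → ℕ) → f L ≤ g L →
                      (∀ r j → r + suc j ≡ L → f r + f (L + suc j) ≤ g r + g (L + suc j)) →
                      sumBelow f (suc (L + L)) ≤ sumBelow g (suc (L + L))
sumBelow-pairwise-≤ zero    f g middle pairs = +-monoˡ-≤ 0 middle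
sumBelow-pairwise-≤ (suc L) f g middle pairs = begin
  sumBelow f (suc (suc L + suc L))
    ≡⟨ sumBelow-outerPair L f ⟩
  f 0 + f (suc L + suc L) + sumBelow (f ∘ suc) (suc (L + L))
    ≤⟨ +-mono-≤ (pairs 0 L refl)
                (sumBelow-pairwise-≤ L (f ∘ suc) (g ∘ suc) middle (λ r j eq → pairs (suc r) j (cong suc eq))) ⟩
  g 0 + g (suc L + suc L) + sumBelow (g ∘ suc) (suc (L + L))
    ≡⟨ sumBelow-outerPair L g ⟨
  sumBelow g (suc (suc L + suc L)) ∎
  where open ≤-Reasoning

sumBelow-jlTerm[k+1]<sumBelow-jlTerm[k] :
  ∀ k → sumBelow (λ t → jlTerm (6 * k + 3) (suc k) (suc k + t)) (suc (k + k))
        ℕ.< sumBelow (λ t → jlTerm (6 * k + 3) k (k + t)) (suc (suc (k + k)))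
sumBelow-jlTerm[k+1]<sumBelow-jlTerm[k] k = begin-strict
  sumBelow (λ t → jlTerm n (suc k) (suc k + t)) (suc (k + k))
    ≤⟨ sumBelow-pairwise-≤ k (λ t → jlTerm n (suc k) (suc k + t)) (λ t → jlTerm n k (suc k + t)) middle
                           (λ r j r+j+1≡k → jlTerm-pair-≤ r (suc j) r+j+1≡k) ⟩
  sumBelow (λ t → jlTerm n k (suc k + t)) (suc (k + k))
    <⟨ m<n+m _ (0<lucasCoeff*C k 0 (4 * k + 2) refl n-size) ⟩
  jlTerm n k (k + 0) + sumBelow (λ t → jlTerm n k (suc k + t)) (suc (k + k))
    ≡⟨ cong (jlTerm n k (k + 0) +_) (sumBelow-cong (suc (k + k)) (λ t → cong (jlTerm n k) (+-suc k t))) ⟨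
  sumBelow (λ t → jlTerm n k (k + t)) (suc (suc (k + k))) ∎
  where
  open ≤-Reasoning
  n : ℕ
  n = 6 * k + 3
  n-size : k + 0 + (k + 0) + suc (4 * k + 2) ≡ 6 * k + 3
  n-size = solve (k ∷ [])
  middle : jlTerm n (suc k) (suc k + k) ≤ jlTerm n k (suc k + k)
  middle = ≤-reflexive (cong (lucasCoeff n (suc k + k) *_) (begin-equality
    (suc k + k) C suc k                   ≡⟨ nCk≡nC[n∸k] (m≤m+n (suc k) k) ⟩
    (suc k + k) C (suc k + k ∸ suc k)     ≡⟨ cong ((suc k + k) C_) (m+n∸m≡n (suc k) k) ⟩
    (suc k + k) C k                       ∎))

fromℕ : ℕ → ℚ
fromℕ n = ℤ.+ n ℚ./ 1

toℚᵘ-/ : ∀ a d → toℚᵘ (ℤ.+ a ℚ./ suc d) ≃ᵘ mkℚᵘ (ℤ.+ a) d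
toℚᵘ-/ a d = *≡* (begin
  ℚᵘ.↥ (toℚᵘ q) ℤ.* ℤ.+ suc d   ≡⟨ cong (ℤ._* ℤ.+ suc d) (ℚP.↥ᵘ-toℚᵘ q) ⟩
  ↥ q ℤ.* ℤ.+ suc d             ≡⟨ cong (↥ q ℤ.*_) (ℚP.↧-normalize a (suc d)) ⟨
  ↥ q ℤ.* (↧ q ℤ.* g)           ≡⟨ regroup (↥ q) (↧ q) g ⟩
  (↥ q ℤ.* g) ℤ.* ↧ q           ≡⟨ cong (ℤ._* ↧ q) (ℚP.↥-normalize a (suc d)) ⟩
  ℤ.+ a ℤ.* ↧ q                 ≡⟨ cong (ℤ.+ a ℤ.*_) (ℚP.↧ᵘ-toℚᵘ q) ⟨
  ℤ.+ a ℤ.* ℚᵘ.↧ (toℚᵘ q)       ∎)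
  where
  open ≡-Reasoning
  q : ℚ
  q = ℤ.+ a ℚ./ suc d
  g : ℤ.ℤ
  g = gcd (ℤ.+ a) (ℤ.+ suc d)
  regroup : ∀ x y z → x ℤ.* (y ℤ.* z) ≡ (x ℤ.* z) ℤ.* y
  regroup = ℤ-solve-∀

/-*-fromℕ : ∀ a d c e → suc d * e ≡ a * c → (ℤ.+ a ℚ./ suc d) ℚ.* fromℕ c ≡ fromℕ e
/-*-fromℕ a d c e [d+1]*e≡a*c = ℚP.toℚᵘ-injective (begin-equality
  toℚᵘ ((ℤ.+ a ℚ./ suc d) ℚ.* fromℕ c)         ≃⟨ ℚP.toℚᵘ-homo-* (ℤ.+ a ℚ./ suc d) (fromℕ c) ⟩
  toℚᵘ (ℤ.+ a ℚ./ suc d) ℚᵘ.* toℚᵘ (fromℕ c)    ≃⟨ ℚᵘP.*-cong (toℚᵘ-/ a d) (toℚᵘ-/ c 0) ⟩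
  mkℚᵘ (ℤ.+ a) d ℚᵘ.* mkℚᵘ (ℤ.+ c) 0            ≃⟨ *≡* cross ⟩
  mkℚᵘ (ℤ.+ e) 0                                ≃⟨ toℚᵘ-/ e 0 ⟨
  toℚᵘ (fromℕ e)                                ∎)
  where
  open ℚᵘP.≤-Reasoning
  e*[d*1+1]≡[d+1]*e : e * suc (d * 1) ≡ suc d * e
  e*[d*1+1]≡[d+1]*e = solve (d ∷ e ∷ [])
  cross : (ℤ.+ a ℤ.* ℤ.+ c) ℤ.* ℤ.+ 1 ≡ ℤ.+ e ℤ.* ℤ.+ suc (d * 1)
  cross = trans (ℤP.*-identityʳ _) (trans (sym (ℤP.pos-* a c))
            (trans (cong ℤ.+_ (sym (trans e*[d*1+1]≡[d+1]*e [d+1]*e≡a*c))) (ℤP.pos-* e (suc (d * 1)))))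

fromℕ-+ : ∀ x y → fromℕ (x + y) ≡ fromℕ x ℚ.+ fromℕ y
fromℕ-+ x y = ℚP.toℚᵘ-injective (begin-equality
  toℚᵘ (fromℕ (x + y))                       ≃⟨ toℚᵘ-/ (x + y) 0 ⟩
  mkℚᵘ (ℤ.+ (x + y)) 0                       ≃⟨ *≡* cross ⟩
  mkℚᵘ (ℤ.+ x) 0 ℚᵘ.+ mkℚᵘ (ℤ.+ y) 0         ≃⟨ ℚᵘP.+-cong (toℚᵘ-/ x 0) (toℚᵘ-/ y 0) ⟨
  toℚᵘ (fromℕ x) ℚᵘ.+ toℚᵘ (fromℕ y)         ≃⟨ ℚP.toℚᵘ-homo-+ (fromℕ x) (fromℕ y) ⟨
  toℚᵘ (fromℕ x ℚ.+ fromℕ y)                 ∎)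
  where
  open ℚᵘP.≤-Reasoning
  regroup : ∀ p q → (p ℤ.+ q) ℤ.* ℤ.+ 1 ≡ (p ℤ.* ℤ.+ 1 ℤ.+ q ℤ.* ℤ.+ 1) ℤ.* ℤ.+ 1
  regroup = ℤ-solve-∀
  cross : ℤ.+ (x + y) ℤ.* ℤ.+ 1 ≡ (ℤ.+ x ℤ.* ℤ.+ 1 ℤ.+ ℤ.+ y ℤ.* ℤ.+ 1) ℤ.* ℤ.+ 1
  cross = trans (cong (ℤ._* ℤ.+ 1) (ℤP.pos-+ x y)) (regroup (ℤ.+ x) (ℤ.+ y))

fromℕ-mono-< : ∀ {x y} → x ℕ.< y → fromℕ x < fromℕ y
fromℕ-mono-< {x} {y} x<y = ℚP.toℚᵘ-cancel-< (begin-strict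
  toℚᵘ (fromℕ x)   ≃⟨ toℚᵘ-/ x 0 ⟩
  mkℚᵘ (ℤ.+ x) 0   <⟨ *<* (ℤP.*-monoʳ-<-pos (ℤ.+ 1) (ℤ.+<+ x<y)) ⟩
  mkℚᵘ (ℤ.+ y) 0   ≃⟨ toℚᵘ-/ y 0 ⟨
  toℚᵘ (fromℕ y)   ∎)
  where open ℚᵘP.≤-Reasoning

p<q⇒p-q<0 : ∀ {p q} → p < q → p ℚ.- q < 0ℚ
p<q⇒p-q<0 {p} {q} p<q = subst (p ℚ.- q <_) (ℚP.+-inverseʳ q) (ℚP.+-monoˡ-< (ℚ.- q) p<q)

ratio*C*C≡fromℕ-jlTerm : ∀ {n} c i → i ℕ.< n → i + i ≤ n →
                         ratio n i ℚ.* fromℕ ((n ∸ i) C i) ℚ.* fromℕ (i C c) ≡ fromℕ (jlTerm n c i)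
ratio*C*C≡fromℕ-jlTerm {n} c i i<n i+i≤n =
  trans (cong (ℚ._* fromℕ (i C c)) (/-*-fromℕ n (n ∸ suc i) ((n ∸ i) C i) w [n∸i]*w≡n*C))
        (/-*-fromℕ w 0 (i C c) (jlTerm n c i) (*-identityˡ (jlTerm n c i)))
  where
  w : ℕ
  w = lucasCoeff n i
  [n∸i]*w≡n*C : suc (n ∸ suc i) * w ≡ n * ((n ∸ i) C i)
  [n∸i]*w≡n*C = trans (cong (_* w) (sym (+-∸-assoc 1 i<n))) ([n∸i]*lucasCoeff≡n*[n∸i]Ci {i = i} i+i≤n)

foldr-+-map-applyUpTo≡fromℕ-sumBelow : ∀ L (f : ℕ → ℚ) s g → (∀ t → t ℕ.< L → f (s t) ≡ fromℕ (g t)) →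
                                       foldr ℚ._+_ 0ℚ (map f (applyUpTo s L)) ≡ fromℕ (sumBelow g L)
foldr-+-map-applyUpTo≡fromℕ-sumBelow zero    f s g f∘s≡g = refl
foldr-+-map-applyUpTo≡fromℕ-sumBelow (suc L) f s g f∘s≡g = begin
  f (s 0) ℚ.+ foldr ℚ._+_ 0ℚ (map f (applyUpTo (s ∘ suc) L))
    ≡⟨ cong₂ ℚ._+_ (f∘s≡g 0 z<s)
               (foldr-+-map-applyUpTo≡fromℕ-sumBelow L f (s ∘ suc) (g ∘ suc) (λ t t<L → f∘s≡g (suc t) (s<s t<L))) ⟩
  fromℕ (g 0) ℚ.+ fromℕ (sumBelow (g ∘ suc) L)
    ≡⟨ fromℕ-+ (g 0) (sumBelow (g ∘ suc) L) ⟨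
  fromℕ (sumBelow g (suc L)) ∎
  where open ≡-Reasoning

sumFromTo≡fromℕ-sumBelow : ∀ a L (f : ℕ → ℚ) g → (∀ t → t ≤ L → f (a + t) ≡ fromℕ (g t)) →
                           sumFromTo a (a + L) f ≡ fromℕ (sumBelow g (suc L))
sumFromTo≡fromℕ-sumBelow a L f g f[a+t]≡g = begin
  foldr ℚ._+_ 0ℚ (map f (map (a +_) (upTo (suc (a + L) ∸ a))))
    ≡⟨ cong (λ m → foldr ℚ._+_ 0ℚ (map f (map (a +_) (upTo m)))) [a+L+1]∸a≡L+1 ⟩
  foldr ℚ._+_ 0ℚ (map f (map (a +_) (upTo (suc L))))
    ≡⟨ cong (foldr ℚ._+_ 0ℚ) (map-∘ {g = f} {f = a +_} (upTo (suc L))) ⟨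
  foldr ℚ._+_ 0ℚ (map (f ∘ (a +_)) (upTo (suc L)))
    ≡⟨ foldr-+-map-applyUpTo≡fromℕ-sumBelow (suc L) (f ∘ (a +_)) id g (λ t t<L+1 → f[a+t]≡g t (s≤s⁻¹ t<L+1)) ⟩
  fromℕ (sumBelow g (suc L)) ∎
  where
  open ≡-Reasoning
  [a+L+1]∸a≡L+1 : suc (a + L) ∸ a ≡ suc L
  [a+L+1]∸a≡L+1 = trans (cong (_∸ a) (sym (+-suc a L))) (m+n∸m≡n a (suc L))

≤half⇒<∧double≤ : ∀ {n i} .{{_ : NonZero n}} → i ≤ n ℕ./ 2 → i ℕ.< n × i + i ≤ n
≤half⇒<∧double≤ {n} {i} i≤n/2 = ≤-<-trans i≤n/2 (m/n<m n 2 (s≤s (s≤s z≤n))) , (begin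
  i + i                 ≤⟨ +-mono-≤ i≤n/2 i≤n/2 ⟩
  n ℕ./ 2 + n ℕ./ 2     ≡⟨ cong (n ℕ./ 2 +_) (+-identityʳ (n ℕ./ 2)) ⟨
  2 * (n ℕ./ 2)         ≡⟨ *-comm 2 (n ℕ./ 2) ⟩
  n ℕ./ 2 * 2           ≤⟨ m/n*n≤m n 2 ⟩
  n                     ∎)
  where open ≤-Reasoning

JL≡fromℕ-sumBelow : ∀ {n} c L .{{_ : NonZero n}} → c + L ≡ n ℕ./ 2 →
                    JL n c ≡ fromℕ (sumBelow (λ t → jlTerm n c (c + t)) (suc L))
JL≡fromℕ-sumBelow {n} c L c+L≡n/2 = begin
  JL n c                    ≡⟨ cong (λ b → sumFromTo c b summand) c+L≡n/2 ⟨
  sumFromTo c (c + L) summand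
    ≡⟨ sumFromTo≡fromℕ-sumBelow c L summand (λ t → jlTerm n c (c + t)) summand≡jlTerm ⟩
  fromℕ (sumBelow (λ t → jlTerm n c (c + t)) (suc L)) ∎
  where
  open ≡-Reasoning
  summand : ℕ → ℚ
  summand i = ratio n i ℚ.* fromℕ ((n ∸ i) C i) ℚ.* fromℕ (i C c)
  summand≡jlTerm : ∀ t → t ≤ L → summand (c + t) ≡ fromℕ (jlTerm n c (c + t))
  summand≡jlTerm t t≤L =
    let i<n , i+i≤n = ≤half⇒<∧double≤ (subst (c + t ≤_) c+L≡n/2 (+-monoʳ-≤ c t≤L))
    in ratio*C*C≡fromℕ-jlTerm c (c + t) i<n i+i≤n

[6k+3]/2≡3k+1 : ∀ k → (6 * k + 3) ℕ./ 2 ≡ 3 * k + 1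
[6k+3]/2≡3k+1 k = begin
  (6 * k + 3) ℕ./ 2                    ≡⟨ cong (ℕ._/ 2) 6k+3≡1+[3k+1]*2 ⟩
  (1 + (3 * k + 1) * 2) ℕ./ 2          ≡⟨ +-distrib-/-∣ʳ 1 {d = 2} (n∣m*n (3 * k + 1)) ⟩
  1 ℕ./ 2 + (3 * k + 1) * 2 ℕ./ 2      ≡⟨ m*n/n≡m (3 * k + 1) 2 ⟩
  3 * k + 1                            ∎
  where
  open ≡-Reasoning
  6k+3≡1+[3k+1]*2 : 6 * k + 3 ≡ 1 + (3 * k + 1) * 2
  6k+3≡1+[3k+1]*2 = solve (k ∷ [])

theorem3p7 : (k : ℕ) → Δ (6 * k + 3) k < 0ℚ
theorem3p7 k = begin-strict
  JL n (suc k) ℚ.- JL n k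
    ≡⟨ cong₂ ℚ._-_ (JL≡fromℕ-sumBelow {n} (suc k) (k + k) (trans [k+1]+2k≡3k+1 (sym ([6k+3]/2≡3k+1 k))))
                   (JL≡fromℕ-sumBelow {n} k (suc (k + k)) (trans k+[2k+1]≡3k+1 (sym ([6k+3]/2≡3k+1 k)))) ⟩
  fromℕ (sumBelow (λ t → jlTerm n (suc k) (suc k + t)) (suc (k + k))) ℚ.- fromℕ (sumBelow (λ t → jlTerm n k (k + t)) (suc (suc (k + k))))
    <⟨ p<q⇒p-q<0 (fromℕ-mono-< (sumBelow-jlTerm[k+1]<sumBelow-jlTerm[k] k)) ⟩
  0ℚ ∎
  where
  open ℚP.≤-Reasoning
  n : ℕ
  n = 6 * k + 3
  instance
    n≢0 : NonZero n
    n≢0 = ≢-nonZero (m+1+n≢0 (6 * k))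
  [k+1]+2k≡3k+1 : suc k + (k + k) ≡ 3 * k + 1
  [k+1]+2k≡3k+1 = solve (k ∷ [])
  k+[2k+1]≡3k+1 : k + suc (k + k) ≡ 3 * k + 1
  k+[2k+1]≡3k+1 = solve (k ∷ [])
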